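{- Let $\mathfrak A$ be a game interface and $S\subseteq P_{\mathfrak A}$ a saturated set of traces. If $s,s'\in S$ satisfy $s'\preccurlyeq s$ and $s\,\alpha\in S$ for a message $\alpha$, then $s'\,\alpha\in S$.
   Context: Fix disjoint sets $\mathbb A$ (port names) and $\mathbb P$ (pointer names); polarities $\{O,P\}$. An interface $A$ is a finite set of ports $(l,a)$ (polarity, port name) with distinct port names; $\mathrm{sup}(A)$ its port names, $A^{(l)}$ its $l$-labelled ports. A game interface is $\mathfrak A=(A,Q_A,I_A,\vdash_A)$: an interface $A$; a partition $\mathrm{sup}(A)=Q_A\uplus\mathcal A_A$ into question and answer port names; a set $I_A$ of initial port names, all $O$-labelled questions; and an enabling relation $\vdash_A$ from question port names to non-initial port names such that $a\vdash_A a'$ implies $a,a'$ have different polarities. Traces. A message is written $(l,a,p,p',d)$: polarity $l$, port name $a\in\mathrm{sup}(A)$, pointer names $p,p'$ and a data value $d$. A trace over $A$ is a finite sequence of messages; $\epsilon$ is the empty trace. $\mathrm{cp}(\epsilon)=\emptyset$, $\mathrm{cp}(s\,(l,a,p,p',d))=\mathrm{cp}(s)\cup\{p'\}$; $\mathrm{fp}(\epsilon)=\emptyset$, $\mathrm{fp}(s\,(l,a,p,p',d))=\mathrm{fp}(s)\cup(\{p\}\setminus\mathrm{cp}(s))$; $\mathrm{ptrs}(s)=\mathrm{cp}(s)\cup\mathrm{fp}(s)$. $\mathrm{enabled}_{\mathfrak A}(\epsilon)=\emptyset$, $\mathrm{enabled}_{\mathfrak A}(s\,(l,a,p,p',d))=\mathrm{enabled}_{\mathfrak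 A}(s)\cup\{(a',p')\mid a\vdash_A a'\}$. A segment of $s$ is $s'$ with $s=s_1s's_2$; a prefix is $s'$ with $s=s's_1$. Legality. $s$ has unique pointers if for every prefix $s'\,(l,a,p,p',d)$ of $s$, $p'\notin\mathrm{ptrs}(s')$; is correctly labelled if every message $(l,a,p,p',d)$ in $s$ has $a\in\mathrm{sup}(A^{(l)})$; is justified if for every prefix $s'\,(l,a,p,p',d)$ with $a\notin I_A$, $(a,p)\in\mathrm{enabled}_{\mathfrak A}(s')$; is strictly scoped if whenever $(l,a,p,p',d)\,s'$ is a segment of $s$ with $a$ an answer, $p\notin\mathrm{fp}(s')$; is strictly nested if whenever $(l_1,a_1,p,p',d_1)\,s'\,(l_2,a_2,p',p'',d_2)\,s''\,(l_3,a_3,p',p''',d_3)$ is a segment of $s$ with $a_1,a_2$ questions and $a_3$ an answer, then $s''$ contains a message $(l_4,a_4,p'',-,d_4)$ with $a_4$ an answer. $P_{\mathfrak A}$ is the set of traces over $A$ that have unique pointers and are correctly labelled, justified, strictly scoped and strictly nested. Swapping preorder and saturation. Order polarities by $O\le O$, $O\le P$, $P\le P$. $\preccurlyeq$ is the least reflexive transitive relation on $P_{\mathfrak A}$ such that if $l_1\le l_2$ and $p_1'\neq p_2$ then $s_1\,(l_1,a_1,p_1,p_1',d_1)\,(l_2,a_2,p_2,p_2',d_2)\,s_2\preccurlyeq s_1\,(l_2,a_2,p_2,p_2',d_2)\,(l_1,a_1,p_1,p_1',d_1)\,s_2$. A set $S\subseteq P_{\mathfrak A}$ is saturated if for all $s,s'\in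 P_{\mathfrak A}$, $s'\preccurlyeq s$ and $s\in S$ imply $s'\in S$. -}

module Defs where

open import Data.List using (List; []; _∷_; _++_; [_]; map)
open import Data.List.Membership.Propositional using (_∈_)
open import Data.List.Relation.Unary.Any using (Any)
open import Data.List.Relation.Unary.All using (All)
open import Data.List.Relation.Unary.Unique.Propositional using (Unique)
open import Data.Product using (_×_; _,_; proj₂; Σ; ∃)
open import Data.Sum using (_⊎_)
open import Relation.Binary.PropositionalEquality using (_≡_; _≢_)
open import Relation.Nullary using (¬_)

data Pol : Set where
  O P : Pol

data _≤ₚ_ : Pol → Pol → Set where
  O≤O : O ≤ₚ O
  O≤P : O ≤ₚ P
  P≤P : P ≤ₚ P

-- 𝔸 : port names, ℙ : pointer names, D : data values
-- (𝔸 and ℙ are separate types, hence disjoint.)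
module _ {𝔸 : Set} where

  record GameInterface : Set₁ where
    field
      ports    : List (Pol × 𝔸)
      distinct : Unique (map proj₂ ports)
      Q        : 𝔸 → Set
      Ans      : 𝔸 → Set
      I        : 𝔸 → Set
      _⊢_      : 𝔸 → 𝔸 → Set
    Sup : 𝔸 → Set
    Sup a = a ∈ map proj₂ ports
    field
      Q⊆sup     : ∀ a → Q a → Sup a
      Ans⊆sup   : ∀ a → Ans a → Sup a
      partition : ∀ a → Sup a → (Q a × ¬ Ans a) ⊎ (Ans a × ¬ Q a)
      I-O       : ∀ a → I a → (O , a) ∈ ports
      I-Q       : ∀ a → I a → Q a
      ⊢-Q       : ∀ a a' → a ⊢ a' → Q a
      ⊢-sup     : ∀ a a' → a ⊢ a' → Sup a'
      ⊢-nonInit : ∀ a a' → a ⊢ a' → ¬ I a'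
      ⊢-pol     : ∀ a a' l l' → a ⊢ a' → (l , a) ∈ ports → (l' , a') ∈ ports → l ≢ l'

module _ {𝔸 ℙ D : Set} where

  record Msg : Set where
    constructor msg
    field
      pol  : Pol
      port : 𝔸
      ptr  : ℙ
      ptr' : ℙ
      dat  : D
  open Msg public

  Trace : Set
  Trace = List Msg

  CP : ℙ → Trace → Set
  CP p s = Any (λ m → ptr' m ≡ p) s

  -- p ∈ fp(s)   (unfolding of the recursive definition)
  FP : ℙ → Trace → Set
  FP p s = Σ Trace λ s₁ → Σ Msg λ m → Σ Trace λ s₂ →
             (s ≡ s₁ ++ m ∷ s₂) × (ptr m ≡ p) × ¬ CP p s₁

  Ptrs : ℙ → Trace → Set
  Ptrs p s = CP p s ⊎ FP p s

  module _ (𝔄 : GameInterface {𝔸}) where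
    open GameInterface 𝔄

    Enabled : Trace → 𝔸 → ℙ → Set
    Enabled s a' p' = Any (λ m → (port m ⊢ a') × (ptr' m ≡ p')) s

    UniquePointers : Trace → Set
    UniquePointers s = ∀ s₁ m s₂ → s ≡ s₁ ++ m ∷ s₂ → ¬ Ptrs (ptr' m) s₁

    CorrectlyLabelled : Trace → Set
    CorrectlyLabelled s = All (λ m → (pol m , port m) ∈ ports) s

    Justified : Trace → Set
    Justified s = ∀ s₁ m s₂ → s ≡ s₁ ++ m ∷ s₂ → ¬ I (port m) →
                  Enabled s₁ (port m) (ptr m)

    StrictlyScoped : Trace → Set
    StrictlyScoped s = ∀ s₁ m s' s₂ → s ≡ s₁ ++ (m ∷ s') ++ s₂ →
                       Ans (port m) → ¬ FP (ptr m) s'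

    StrictlyNested : Trace → Set
    StrictlyNested s = ∀ s₀ m₁ s' m₂ s'' m₃ s₃ →
      s ≡ s₀ ++ (m₁ ∷ s') ++ (m₂ ∷ s'') ++ (m₃ ∷ s₃) →
      ptr m₂ ≡ ptr' m₁ → ptr m₃ ≡ ptr' m₁ →
      Q (port m₁) → Q (port m₂) → Ans (port m₃) →
      Any (λ m₄ → (ptr m₄ ≡ ptr' m₂) × Ans (port m₄)) s''

    Legal : Trace → Set
    Legal s = UniquePointers s × CorrectlyLabelled s × Justified s
              × StrictlyScoped s × StrictlyNested s

    data _≼_ : Trace → Trace → Set where
      ≼-refl  : ∀ {s} → Legal s → s ≼ s
      ≼-trans : ∀ {s₁ s₂ s₃} → s₁ ≼ s₂ → s₂ ≼ s₃ → s₁ ≼ s₃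
      ≼-swap  : ∀ s₁ m₁ m₂ s₂ →
                Legal (s₁ ++ m₁ ∷ m₂ ∷ s₂) → Legal (s₁ ++ m₂ ∷ m₁ ∷ s₂) →
                pol m₁ ≤ₚ pol m₂ → ptr' m₁ ≢ ptr m₂ →
                (s₁ ++ m₁ ∷ m₂ ∷ s₂) ≼ (s₁ ++ m₂ ∷ m₁ ∷ s₂)

    SubsetLegal : (Trace → Set) → Set
    SubsetLegal S = ∀ s → S s → Legal s

    Saturated : (Trace → Set) → Set
    Saturated S = ∀ s s' → Legal s → Legal s' → s' ≼ s → S s → S s'

module Submission where

open import Defs
open import Data.List using (List; []; _∷_; _++_; [_]; _∷ʳ_)
open import Data.List.Properties using (++-assoc; ++-identityʳ; ∷-injective)
open import Data.List.Membership.Propositional using (_∈_; find)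
open import Data.List.Membership.Propositional.Properties using (∈-∃++)
open import Data.List.Relation.Unary.Any using (Any; here; there)
import Data.List.Relation.Unary.Any as Any
open import Data.List.Relation.Unary.Any.Properties using (++⁺ˡ; ++⁺ʳ; ++⁻)
import Data.List.Relation.Unary.All as All
import Data.List.Relation.Unary.All.Properties as AllP
open import Data.List.Relation.Binary.Permutation.Propositional using (_↭_; ↭-refl; ↭-swap)
import Data.List.Relation.Binary.Permutation.Propositional.Properties as ↭
open import Data.Product using (_×_; _,_; proj₁; ∃)
open import Data.Sum using (_⊎_; inj₁; inj₂)
open import Data.Empty using (⊥-elim)
open import Relation.Binary.PropositionalEquality using (_≡_; _≢_; refl; sym; trans; cong; subst; subst₂)
open import Relation.Nullary using (¬_)
open import Function using (_∘_)

-- Legality of a trace u α splits into legality of u and a handful of conditions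
-- relating α to u.  Phrased through membership (Any) rather than through
-- positions, these conditions survive swapping two adjacent messages x y of u
-- with ptr' x ≠ ptr y; the symmetric inequality ptr' y ≠ ptr x holds anyway,
-- as y's new pointer is fresh.  So every swap s₁ x y s₂ ≼ s₁ y x s₂ extends to
-- s₁ x y s₂ α ≼ s₁ y x s₂ α; by induction on s' ≼ s we get s' α ≼ s α, and
-- saturation of S transports s α ∈ S to s' α.

module _ {X : Set} where

  ∷ʳ-≡-++ : ∀ (A B u : List X) α → u ∷ʳ α ≡ A ++ B →
            (B ≡ [] × A ≡ u ∷ʳ α) ⊎ ∃ λ B′ → B ≡ B′ ∷ʳ α × u ≡ A ++ B′
  ∷ʳ-≡-++ []            B       u       α eq = inj₂ (u , sym eq , refl)
  ∷ʳ-≡-++ (a ∷ [])      []      []      α refl = inj₁ (refl , refl)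
  ∷ʳ-≡-++ (a ∷ [])      (_ ∷ _) []      α ()
  ∷ʳ-≡-++ (a ∷ _ ∷ _)   B       []      α ()
  ∷ʳ-≡-++ (a ∷ A)       B       (v ∷ u) α eq with refl , eq′ ← ∷-injective eq
    with ∷ʳ-≡-++ A B u α eq′
  ... | inj₁ (B≡[] , A≡) = inj₁ (B≡[] , cong (a ∷_) A≡)
  ... | inj₂ (B′ , B≡ , u≡) = inj₂ (B′ , B≡ , cong (a ∷_) u≡)

  ∷ʳ-≡-++-∷ : ∀ (s₁ : List X) m s₂ u α → u ∷ʳ α ≡ s₁ ++ m ∷ s₂ →
              (s₁ ≡ u × m ≡ α × s₂ ≡ []) ⊎ ∃ λ s₂′ → s₂ ≡ s₂′ ∷ʳ α × u ≡ s₁ ++ m ∷ s₂′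
  ∷ʳ-≡-++-∷ s₁ m s₂ u α eq with ∷ʳ-≡-++ s₁ (m ∷ s₂) u α eq
  ... | inj₁ (() , _)
  ... | inj₂ ([] , refl , u≡) = inj₁ (sym (trans u≡ (++-identityʳ s₁)) , refl , refl)
  ... | inj₂ (m′ ∷ s₂′ , refl , refl) = inj₂ (s₂′ , refl , refl)

  ++-assoc³ : ∀ (a b c d : List X) → ((a ++ b) ++ c) ++ d ≡ a ++ b ++ c ++ d
  ++-assoc³ a b c d = trans (++-assoc (a ++ b) c d) (++-assoc a b (c ++ d))

  ++-∷-++-[] : ∀ (s₁ : List X) m r → s₁ ++ m ∷ r ≡ s₁ ++ (m ∷ r) ++ []
  ++-∷-++-[] s₁ m r = cong (s₁ ++_) (sym (++-identityʳ (m ∷ r)))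

  Any⇒∃++ : ∀ {P : X → Set} {u} → Any P u →
            ∃ λ s₁ → ∃ λ m → ∃ λ s₂ → u ≡ s₁ ++ m ∷ s₂ × P m
  Any⇒∃++ pu with m , m∈u , pm ← find pu with s₁ , s₂ , u≡ ← ∈-∃++ m∈u =
    s₁ , m , s₂ , u≡ , pm

  ++-swap-↭ : ∀ (s₁ : List X) x y s₂ → s₁ ++ x ∷ y ∷ s₂ ↭ s₁ ++ y ∷ x ∷ s₂
  ++-swap-↭ s₁ x y s₂ = ↭.++⁺ˡ s₁ (↭-swap x y ↭-refl)

  Any-swap : ∀ {P : X → Set} s₁ x y s₂ → Any P (s₁ ++ x ∷ y ∷ s₂) → Any P (s₁ ++ y ∷ x ∷ s₂)
  Any-swap s₁ x y s₂ = ↭.Any-resp-↭ (++-swap-↭ s₁ x y s₂)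

  data SwapPosition (x y : X) : List X → List X → List X → X → List X → Set where
    before : ∀ pre m q s₂ → SwapPosition x y (pre ++ m ∷ q) s₂ pre m (q ++ x ∷ y ∷ s₂)
    at-x   : ∀ s₁ s₂ → SwapPosition x y s₁ s₂ s₁ x (y ∷ s₂)
    at-y   : ∀ s₁ s₂ → SwapPosition x y s₁ s₂ (s₁ ∷ʳ x) y s₂
    after  : ∀ s₁ q m post → SwapPosition x y s₁ (q ++ m ∷ post) (s₁ ++ x ∷ y ∷ q) m post

  swapPosition : ∀ x y s₁ s₂ pre m post → s₁ ++ x ∷ y ∷ s₂ ≡ pre ++ m ∷ post →
                 SwapPosition x y s₁ s₂ pre m post
  swapPosition x y []       s₂ []            m post refl = at-x [] s₂
  swapPosition x y []       s₂ (_ ∷ [])      m post refl = at-y [] s₂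
  swapPosition x y []       s₂ (_ ∷ _ ∷ pre) m post refl = after [] pre m post
  swapPosition x y (z ∷ s₁) s₂ []            m post refl = before [] z s₁ s₂
  swapPosition x y (z ∷ s₁) s₂ (_ ∷ pre)     m post eq with refl , eq′ ← ∷-injective eq
    with swapPosition x y s₁ s₂ pre m post eq′
  ... | before pre m q s₂ = before (z ∷ pre) m q s₂
  ... | at-x s₁ s₂ = at-x (z ∷ s₁) s₂
  ... | at-y s₁ s₂ = at-y (z ∷ s₁) s₂
  ... | after s₁ q m post = after (z ∷ s₁) q m post

module _ {𝔸 ℙ D : Set} (𝔄 : GameInterface {𝔸}) where
  open GameInterface 𝔄

  private
    Tr = Trace {𝔸} {ℙ} {D}
    M  = Msg {𝔸} {ℙ} {D}

    infix 4 _≼ᴬ_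
    _≼ᴬ_ : Tr → Tr → Set
    _≼ᴬ_ = _≼_ 𝔄

  Mentions : ℙ → M → Set
  Mentions p m = ptr m ≡ p ⊎ ptr' m ≡ p

  Ptrs⇒mentioned : ∀ {p} (u : Tr) → Ptrs p u → Any (Mentions p) u
  Ptrs⇒mentioned u (inj₁ cp) = Any.map inj₂ cp
  Ptrs⇒mentioned u (inj₂ (s₁ , m , s₂ , refl , ptr≡ , _)) = ++⁺ʳ s₁ (here (inj₁ ptr≡))

  ¬Ptrs⇒¬mentioned : ∀ {p} (u : Tr) → ¬ Ptrs p u → ¬ Any (Mentions p) u
  ¬Ptrs⇒¬mentioned u ¬ptrs mentioned with Any⇒∃++ mentioned
  ... | s₁ , m , s₂ , refl , inj₂ ptr'≡ = ¬ptrs (inj₁ (++⁺ʳ s₁ (here ptr'≡)))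
  ... | s₁ , m , s₂ , refl , inj₁ ptr≡ =
    ¬ptrs (inj₂ (s₁ , m , s₂ , refl , ptr≡ , λ cp → ¬ptrs (inj₁ (++⁺ˡ cp))))

  ¬FP-[] : ∀ {p} → ¬ FP {𝔸} {ℙ} {D} p []
  ¬FP-[] ([] , _ , _ , () , _)
  ¬FP-[] (_ ∷ _ , _ , _ , () , _)

  FP-∷ʳ⁻ : ∀ {p} (r : Tr) α → FP p (r ∷ʳ α) → FP p r ⊎ (ptr α ≡ p × ¬ CP p r)
  FP-∷ʳ⁻ r α (s₁ , m , s₂ , eq , ptr≡ , ¬cp) with ∷ʳ-≡-++-∷ s₁ m s₂ r α eq
  ... | inj₁ (refl , refl , _) = inj₂ (ptr≡ , ¬cp)
  ... | inj₂ (s₂′ , _ , r≡) = inj₁ (s₁ , m , s₂′ , r≡ , ptr≡ , ¬cp)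

  unique⇒ptr'≢earlier-ptr : ∀ (s₁ : Tr) x y s₂ → UniquePointers 𝔄 (s₁ ++ x ∷ y ∷ s₂) → ptr' y ≢ ptr x
  unique⇒ptr'≢earlier-ptr s₁ x y s₂ unique ptr'≡ =
    ¬Ptrs⇒¬mentioned (s₁ ∷ʳ x) (unique (s₁ ∷ʳ x) y s₂ (sym (++-assoc s₁ [ x ] (y ∷ s₂))))
      (++⁺ʳ s₁ (here (inj₁ (sym ptr'≡))))

  Asks : ℙ → M → Set
  Asks p m = ptr' m ≡ p × Q (port m)

  Answers : ℙ → M → Set
  Answers p m = ptr m ≡ p × Ans (port m)

  -- What strict scoping and strict nesting of u α require of the segments ending in α.
  ScopedBefore : Tr → M → Set
  ScopedBefore u α = ∀ s₁ m r → u ≡ s₁ ++ m ∷ r → Ans (port m) → ptr α ≡ ptr m → ¬ ¬ CP (ptr m) r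

  NestedBefore : Tr → M → Set
  NestedBefore u α = ∀ pre m₂ r → u ≡ pre ++ m₂ ∷ r → Q (port m₂) → Ans (port α) →
                     Any (Asks (ptr m₂)) pre → ptr α ≡ ptr m₂ → Any (Answers (ptr' m₂)) r

  record LegalExtension (u : Tr) (α : M) : Set where
    field
      fresh     : ¬ Any (Mentions (ptr' α)) u
      labelled  : (pol α , port α) ∈ ports
      justified : ¬ I (port α) → Enabled 𝔄 u (port α) (ptr α)
      scoped    : ScopedBefore u α
      nested    : NestedBefore u α

  legal-∷ʳ⁻ : ∀ u α → Legal 𝔄 (u ∷ʳ α) → LegalExtension u α
  legal-∷ʳ⁻ u α (unique , labelled , justified , scoped , nested) = record
    { fresh     = ¬Ptrs⇒¬mentioned u (unique u α [] refl)
    ; labelled  = All.head (AllP.++⁻ʳ u labelled)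
    ; justified = justified u α [] refl
    ; scoped    = scoped-α
    ; nested    = nested-α
    }
    where
    scoped-α : ScopedBefore u α
    scoped-α s₁ m r refl ans ptr≡ ¬cp =
      scoped s₁ m (r ∷ʳ α) [] (trans (++-assoc s₁ (m ∷ r) [ α ]) (++-∷-++-[] s₁ m (r ∷ʳ α))) ans
        (r , α , [] , refl , ptr≡ , ¬cp)
    nested-α : NestedBefore u α
    nested-α pre m₂ r refl q₂ ans asks ptr≡ with Any⇒∃++ asks
    ... | s₀ , m₁ , s′ , refl , (ptr'≡ , q₁) =
      nested s₀ m₁ s′ m₂ r α [] (++-assoc³ s₀ (m₁ ∷ s′) (m₂ ∷ r) [ α ])
        (sym ptr'≡) (trans ptr≡ (sym ptr'≡)) q₁ q₂ ans

  module _ {u : Tr} {α : M} (ext : LegalExtension u α) where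
    open LegalExtension ext

    unique-∷ʳ⁺ : UniquePointers 𝔄 u → UniquePointers 𝔄 (u ∷ʳ α)
    unique-∷ʳ⁺ unique s₁ m s₂ eq with ∷ʳ-≡-++-∷ s₁ m s₂ u α eq
    ... | inj₁ (refl , refl , _) = λ ptrs → fresh (Ptrs⇒mentioned s₁ ptrs)
    ... | inj₂ (s₂′ , _ , u≡) = unique s₁ m s₂′ u≡

    justified-∷ʳ⁺ : Justified 𝔄 u → Justified 𝔄 (u ∷ʳ α)
    justified-∷ʳ⁺ just s₁ m s₂ eq ¬init with ∷ʳ-≡-++-∷ s₁ m s₂ u α eq
    ... | inj₁ (refl , refl , _) = justified ¬init
    ... | inj₂ (s₂′ , _ , u≡) = just s₁ m s₂′ u≡ ¬init

    scoped-∷ʳ⁺ : StrictlyScoped 𝔄 u → StrictlyScoped 𝔄 (u ∷ʳ α)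
    scoped-∷ʳ⁺ scope s₁ m s′ s₂ eq ans fp
      with ∷ʳ-≡-++ (s₁ ++ m ∷ s′) s₂ u α (trans eq (sym (++-assoc s₁ (m ∷ s′) s₂)))
    ... | inj₂ (s₂′ , refl , u≡) = scope s₁ m s′ s₂′ (trans u≡ (++-assoc s₁ (m ∷ s′) s₂′)) ans fp
    ... | inj₁ (refl , u∷α≡) with ∷ʳ-≡-++-∷ s₁ m s′ u α (sym u∷α≡)
    ...   | inj₁ (_ , _ , refl) = ¬FP-[] fp
    ...   | inj₂ (s″ , refl , u≡) with FP-∷ʳ⁻ s″ α fp
    ...     | inj₁ fp″ = scope s₁ m s″ [] (trans u≡ (++-∷-++-[] s₁ m s″)) ans fp″
    ...     | inj₂ (ptr≡ , ¬cp) = scoped s₁ m s″ u≡ ans ptr≡ ¬cp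

    nested-∷ʳ⁺ : StrictlyNested 𝔄 u → StrictlyNested 𝔄 (u ∷ʳ α)
    nested-∷ʳ⁺ nest s₀ m₁ s′ m₂ s″ m₃ s₃ eq ptr₂≡ ptr₃≡ q₁ q₂ ans₃
      with ∷ʳ-≡-++-∷ ((s₀ ++ m₁ ∷ s′) ++ m₂ ∷ s″) m₃ s₃ u α
             (trans eq (sym (++-assoc³ s₀ (m₁ ∷ s′) (m₂ ∷ s″) (m₃ ∷ s₃))))
    ... | inj₁ (refl , refl , refl) =
      nested (s₀ ++ m₁ ∷ s′) m₂ s″ refl q₂ ans₃ (++⁺ʳ s₀ (here (sym ptr₂≡ , q₁))) (trans ptr₃≡ (sym ptr₂≡))
    ... | inj₂ (s₃′ , refl , u≡) =
      nest s₀ m₁ s′ m₂ s″ m₃ s₃′ (trans u≡ (++-assoc³ s₀ (m₁ ∷ s′) (m₂ ∷ s″) (m₃ ∷ s₃′)))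
        ptr₂≡ ptr₃≡ q₁ q₂ ans₃

    legal-∷ʳ⁺ : Legal 𝔄 u → Legal 𝔄 (u ∷ʳ α)
    legal-∷ʳ⁺ (unique , correct , just , scope , nest) =
      unique-∷ʳ⁺ unique , AllP.++⁺ correct (labelled All.∷ All.[]) , justified-∷ʳ⁺ just ,
      scoped-∷ʳ⁺ scope , nested-∷ʳ⁺ nest

  module _ (s₁ : Tr) (x y : M) (s₂ : Tr) (α : M) where

    ScopedBefore-swap : ptr' x ≢ ptr y → ScopedBefore (s₁ ++ y ∷ x ∷ s₂) α → ScopedBefore (s₁ ++ x ∷ y ∷ s₂) α
    ScopedBefore-swap ptr'x≢ptry scoped pre m r eq ans ptr≡ ¬cp with swapPosition x y s₁ s₂ pre m r eq
    ... | before pre m q s₂ =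
      scoped pre m (q ++ y ∷ x ∷ s₂) (++-assoc pre (m ∷ q) (y ∷ x ∷ s₂)) ans ptr≡ (¬cp ∘ Any-swap q y x s₂)
    ... | at-x s₁ s₂ = scoped (s₁ ∷ʳ y) x s₂ (sym (++-assoc s₁ [ y ] (x ∷ s₂))) ans ptr≡ (¬cp ∘ there)
    ... | at-y s₁ s₂ = scoped s₁ y (x ∷ s₂) refl ans ptr≡ λ where
      (here ptr'x≡) → ptr'x≢ptry ptr'x≡
      (there cp)    → ¬cp cp
    ... | after s₁ q m post =
      scoped (s₁ ++ y ∷ x ∷ q) m post (sym (++-assoc s₁ (y ∷ x ∷ q) (m ∷ post))) ans ptr≡ ¬cp

    NestedBefore-swap : ptr' x ≢ ptr y → ptr' y ≢ ptr x →
                        NestedBefore (s₁ ++ y ∷ x ∷ s₂) α → NestedBefore (s₁ ++ x ∷ y ∷ s₂) α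
    NestedBefore-swap ptr'x≢ptry ptr'y≢ptrx nested pre m₂ r eq q₂ ans asks ptr≡
      with swapPosition x y s₁ s₂ pre m₂ r eq
    ... | before pre m q s₂ =
      Any-swap q y x s₂ (nested pre m (q ++ y ∷ x ∷ s₂) (++-assoc pre (m ∷ q) (y ∷ x ∷ s₂)) q₂ ans asks ptr≡)
    ... | at-x s₁ s₂ =
      there (nested (s₁ ∷ʳ y) x s₂ (sym (++-assoc s₁ [ y ] (x ∷ s₂))) q₂ ans (++⁺ˡ asks) ptr≡)
    ... | at-y s₁ s₂ = skip-x (nested s₁ y (x ∷ s₂) refl q₂ ans asks-in-s₁ ptr≡)
      where
      asks-in-s₁ : Any (Asks (ptr y)) s₁
      asks-in-s₁ with ++⁻ s₁ asks
      ... | inj₁ asks′ = asks′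
      ... | inj₂ (here (ptr'x≡ , _)) = ⊥-elim (ptr'x≢ptry ptr'x≡)
      skip-x : Any (Answers (ptr' y)) (x ∷ s₂) → Any (Answers (ptr' y)) s₂
      skip-x (here (ptrx≡ , _)) = ⊥-elim (ptr'y≢ptrx (sym ptrx≡))
      skip-x (there answers) = answers
    ... | after s₁ q m post =
      nested (s₁ ++ y ∷ x ∷ q) m post (sym (++-assoc s₁ (y ∷ x ∷ q) (m ∷ post))) q₂ ans
        (Any-swap s₁ x y q asks) ptr≡

    LegalExtension-swap : ptr' x ≢ ptr y → ptr' y ≢ ptr x →
                          LegalExtension (s₁ ++ y ∷ x ∷ s₂) α → LegalExtension (s₁ ++ x ∷ y ∷ s₂) α
    LegalExtension-swap ptr'x≢ptry ptr'y≢ptrx ext = record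
      { fresh     = fresh ∘ Any-swap s₁ x y s₂
      ; labelled  = labelled
      ; justified = Any-swap s₁ y x s₂ ∘ justified
      ; scoped    = ScopedBefore-swap ptr'x≢ptry scoped
      ; nested    = NestedBefore-swap ptr'x≢ptry ptr'y≢ptrx nested
      }
      where open LegalExtension ext

  ≼-legalˡ : ∀ {s′ s : Tr} → s′ ≼ᴬ s → Legal 𝔄 s′
  ≼-legalˡ (≼-refl legal) = legal
  ≼-legalˡ (≼-trans p _) = ≼-legalˡ p
  ≼-legalˡ (≼-swap _ _ _ _ legal _ _ _) = legal

  ≼-∷ʳ : ∀ {s′ s : Tr} α → s′ ≼ᴬ s → Legal 𝔄 (s ∷ʳ α) → s′ ∷ʳ α ≼ᴬ s ∷ʳ α
  ≼-∷ʳ α (≼-refl _) legal = ≼-refl legal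
  ≼-∷ʳ {s = s} α (≼-trans {s₂ = t} p q) legal = ≼-trans (≼-∷ʳ α p (≼-legalˡ qα)) qα
    where
    qα : t ∷ʳ α ≼ᴬ s ∷ʳ α
    qα = ≼-∷ʳ α q legal
  ≼-∷ʳ α (≼-swap s₁ x y s₂ legal-xy _ pol≤ ptr'x≢ptry) legal-yxα =
    subst₂ _≼ᴬ_ (sym (++-assoc s₁ (x ∷ y ∷ s₂) [ α ])) (sym (++-assoc s₁ (y ∷ x ∷ s₂) [ α ]))
      (≼-swap s₁ x y (s₂ ∷ʳ α)
        (subst (Legal 𝔄) (++-assoc s₁ (x ∷ y ∷ s₂) [ α ]) legal-xyα)
        (subst (Legal 𝔄) (++-assoc s₁ (y ∷ x ∷ s₂) [ α ]) legal-yxα) pol≤ ptr'x≢ptry)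
    where
    ptr'y≢ptrx : ptr' y ≢ ptr x
    ptr'y≢ptrx = unique⇒ptr'≢earlier-ptr s₁ x y s₂ (proj₁ legal-xy)
    legal-xyα : Legal 𝔄 ((s₁ ++ x ∷ y ∷ s₂) ∷ʳ α)
    legal-xyα = legal-∷ʳ⁺ (LegalExtension-swap s₁ x y s₂ α ptr'x≢ptry ptr'y≢ptrx
                             (legal-∷ʳ⁻ (s₁ ++ y ∷ x ∷ s₂) α legal-yxα)) legal-xy

lemma4 : {𝔸 ℙ D : Set} (𝔄 : GameInterface {𝔸}) (S : Trace {𝔸} {ℙ} {D} → Set) →
    SubsetLegal 𝔄 S → Saturated 𝔄 S →
    (s s' : Trace {𝔸} {ℙ} {D}) (α : Msg {𝔸} {ℙ} {D}) →
    S s → S s' → _≼_ 𝔄 s' s → S (s ++ [ α ]) → S (s' ++ [ α ])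
lemma4 𝔄 S S⊆legal saturated s s' α _ _ s'≼s Ssα =
  saturated (s ∷ʳ α) (s' ∷ʳ α) legal-sα (≼-legalˡ 𝔄 s'α≼sα) s'α≼sα Ssα
  where
  legal-sα : Legal 𝔄 (s ∷ʳ α)
  legal-sα = S⊆legal (s ∷ʳ α) Ssα
  s'α≼sα : _≼_ 𝔄 (s' ∷ʳ α) (s ∷ʳ α)
  s'α≼sα = ≼-∷ʳ 𝔄 α s'≼s legal-sα
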